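{- Let $w$ be a word of length $n$ over the alphabet $\Sigma$. Let $\mathcal{H}=\mathcal{P}_w(1,h)$ and $\mathcal{P}=\mathcal{P}_w(h+1,p)$. Let $i=h+kp$ with $k>0$ an integer, such that $p\le n-i$ and $(h,p)$ is an Abelian period of $w[1..i]$ with an empty tail. Then the following two conditions are equivalent: (1) $(h,p)$ is an Abelian period of $w[1..i+p]$; (2) for all $a\in\Sigma$, $\mathrm{select}_a\big(w,\ \mathcal{H}[\mathrm{ind}(a)]+(1+\lfloor i/p\rfloor)\times\mathcal{P}[\mathrm{ind}(a)]\big)$ is defined and is $\le i+p$.
   Context: Let $\Sigma=\{a_1,\dots,a_\sigma\}$ with $\mathrm{ind}(a_j)=j$. Positions of $w$ start at 1; $w[1..i]$ is the prefix of length $i$; $|u|_a$ is the number of occurrences of $a$ in $u$; $\mathcal{P}_u=(|u|_{a_1},\dots,|u|_{a_\sigma})$ is the Parikh vector, $|\mathcal{P}|$ its norm (sum of components), and $\mathcal{P}_w(j,m)$ is the Parikh vector of the length-$m$ factor of $w$ starting at position $j$ (the zero vector if $m=0$). For Parikh vectors, $\mathcal{P}\subset\mathcal{Q}$ means $\mathcal{P}[j]\le\mathcal{Q}[j]$ for all $j$ and $|\mathcal{P}|<|\mathcal{Q}|$. A word $u$ has Abelian period $(h,p)$ if $u=u_0u_1\cdots u_{k-1}u_k$ for some $k\ge2$ with $\mathcal{P}_{u_0}\subset\mathcal{P}_{u_1}=\cdots=\mathcal{P}_{u_{k-1}}\supset\mathcal{P}_{u_k}$, $|u_0|=h$, $|u_1|=p$;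 $u_0$ is the head and $u_k$ the tail (the tail is empty when $|u|-h$ is a multiple of $p$). For $a\in\Sigma$ and $m\ge1$, $\mathrm{select}_a(w,m)$ is the position in $w$ of the $m$-th occurrence of $a$ (undefined if $|w|_a<m$), and $\mathrm{select}_a(w,0)=0$. -}

module Defs where

open import Data.Nat using (ℕ; zero; suc; _+_; _≤_; _<_)
open import Data.Fin using (Fin)
open import Data.Fin.Properties using (_≟_)
open import Data.List using (List; []; _∷_; _++_; length; concat; map; allFin; take; drop)
open import Data.Nat.ListAction using (sum)
open import Data.List.Relation.Unary.All using (All)
open import Data.Maybe using (Maybe; just; nothing)
import Data.Maybe as Maybe
open import Data.Product using (Σ; _×_; ∃; ∃-syntax)
open import Relation.Nullary using (yes; no)
open import Relation.Binary.PropositionalEquality using (_≡_)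

-- Alphabet Σ = {a_1,…,a_σ} is Fin σ; ind(a) corresponds to a itself
-- (Parikh vectors are indexed by Fin σ). Words are lists over Fin σ.
Word : ℕ → Set
Word σ = List (Fin σ)

count : ∀ {σ} → Fin σ → Word σ → ℕ
count a []       = 0
count a (x ∷ u) with x ≟ a
... | yes _ = suc (count a u)
... | no  _ = count a u

ParikhVec : ℕ → Set
ParikhVec σ = Fin σ → ℕ

parikh : ∀ {σ} → Word σ → ParikhVec σ
parikh u a = count a u

norm : ∀ {σ} → ParikhVec σ → ℕ
norm {σ} P = sum (map P (allFin σ))

_⊂_ : ∀ {σ} → ParikhVec σ → ParikhVec σ → Set
P ⊂ Q = (∀ a → P a ≤ Q a) × (norm P < norm Q)

_≈ₚ_ : ∀ {σ} → ParikhVec σ → ParikhVec σ → Set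
P ≈ₚ Q = ∀ a → P a ≡ Q a

-- 𝒫_w(j,m): Parikh vector of the length-m factor starting at (1-based) position j
parikhFactor : ∀ {σ} → Word σ → ℕ → ℕ → ParikhVec σ
parikhFactor w j m = parikh (take m (drop (j Data.Nat.∸ 1) w))

-- u = u₀ u₁ ⋯ u_{k-1} u_k with k = 2 + length rest ≥ 2, where the middle
-- blocks are u₁ ∷ rest, 𝒫_{u₀} ⊂ 𝒫_{u₁} = ⋯ = 𝒫_{u_{k-1}} ⊃ 𝒫_{u_k},
-- |u₀| = h, |u₁| = p.  The last argument is the tail u_k.
AbelianDecomp : ∀ {σ} → Word σ → ℕ → ℕ → Word σ → Set
AbelianDecomp {σ} u h p uk =
  Σ (Word σ) λ u0 → Σ (Word σ) λ u1 → Σ (List (Word σ)) λ rest →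
    (u ≡ u0 ++ (u1 ++ (concat rest ++ uk)))
    × (length u0 ≡ h) × (length u1 ≡ p)
    × All (λ v → parikh v ≈ₚ parikh u1) rest
    × (parikh u0 ⊂ parikh u1)
    × (parikh uk ⊂ parikh u1)

AbelianPeriod : ∀ {σ} → Word σ → ℕ → ℕ → Set
AbelianPeriod {σ} u h p = Σ (Word σ) λ uk → AbelianDecomp u h p uk

AbelianPeriodEmptyTail : ∀ {σ} → Word σ → ℕ → ℕ → Set
AbelianPeriodEmptyTail u h p = AbelianDecomp u h p []

-- select_a(w,m): position (1-based) of the m-th occurrence of a in w;
-- nothing = undefined; select_a(w,0) = 0.
select : ∀ {σ} → Fin σ → Word σ → ℕ → Maybe ℕ
select a w       zero    = just 0
select a []      (suc m) = nothing
select a (x ∷ w) (suc m) with x ≟ a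
... | yes _ = Maybe.map suc (select a w m)
... | no  _ = Maybe.map suc (select a w (suc m))

module Submission where

-- Let d be a decomposition of u = w[1..i] with head u₀ (|u₀| = h), first
-- block u₁ (|u₁| = p), B blocks in total and empty tail, so i = h + B·p and
-- i / p = B.  Write b = w[i+1..i+p].  The proof rests on three observations.
--  * Counting letters: |u|ₐ = |u₀|ₐ + B·|u₁|ₐ + |tail|ₐ, for every
--    decomposition (any additive measure of the spine u₀ u₁ ⋯ u_{k-1} u_k).
--  * (h,p) is an Abelian period of u b iff every letter a occurs in u b at
--    least |u₀|ₐ + (B+1)·|u₁|ₐ times.  (⇒) any decomposition of u b has the same
--    head and first block, and comparing lengths it has exactly B + 1 blocks;
--    (⇐) the inequality says |b|ₐ ≥ |u₁|ₐ for all a, and since |b| = |u₁| the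
--    Parikh vectors coincide, so b is one more block.
--  * select_a(w, m) is defined and ≤ n iff m ≤ |w[1..n]|ₐ.
-- The theorem combines these with 𝓗 = 𝒫(u₀), 𝒫 = 𝒫(u₁) and 1 + i / p = B + 1.

open import Defs
open import Data.Nat
  using (ℕ; zero; suc; _+_; _*_; _∸_; _≤_; _<_; z≤n; s≤s; s≤s⁻¹; NonZero; ≢-nonZero⁻¹; >-nonZero⁻¹)
open import Data.Nat.Properties
  using (+-commutativeSemigroup; ≤-antisym; ≤-reflexive; ≤-trans; <⇒≤; <⇒≱; n≤0⇒n≡0; +-assoc; +-comm;
         +-identityʳ; +-cancelˡ-≡; +-cancelˡ-≤; +-cancelʳ-≤; +-mono-≤; +-monoʳ-≤; m≤m+n; m≤n⇒m⊓n≡m;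
         m+n∸n≡m; m∸n≢0⇒n<m)
open import Algebra.Properties.CommutativeSemigroup +-commutativeSemigroup
  using () renaming (interchange to +-interchange)
open import Data.Nat.DivMod using (_/_; /-congˡ; m<n⇒m/n≡0; m*n/n≡m; +-distrib-/-∣ʳ)
open import Data.Nat.Divisibility using (divides-refl)
open import Data.Nat.ListAction using (sum)
open import Data.Fin using (Fin; zero; suc)
open import Data.Fin.Properties using (_≟_)
open import Data.List using (List; []; _∷_; _++_; _∷ʳ_; length; take; drop; concat)
open import Data.List.Properties
  using (map-tabulate; take-[]; length-++; length-take; length-drop; take++drop≡id; ++-assoc;
         ++-identityʳ; concat-++)
open import Data.List.Relation.Unary.All using (All; []; _∷_)
import Data.List.Relation.Unary.All as All
open import Data.List.Relation.Unary.All.Properties using (∷ʳ⁺)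
open import Data.Maybe using (Maybe; just)
import Data.Maybe as Maybe
open import Data.Product using (_,_; _×_; ∃; proj₁; proj₂)
open import Function using (id; _∘_)
open import Function.Bundles using (_⇔_; mk⇔; Equivalence)
open import Relation.Nullary using (yes; no; contradiction)
open import Relation.Binary.PropositionalEquality

variable
  σ : ℕ

+-squeezeˡ : ∀ {a b c d} → a ≤ b → c ≤ d → a + c ≡ b + d → a ≡ b
+-squeezeˡ {a} {b} {c} {d} a≤b c≤d e =
  ≤-antisym a≤b (+-cancelʳ-≤ d b a (subst (_≤ a + d) e (+-monoʳ-≤ a c≤d)))

[r+q*p]/p≡q : ∀ {r q p} .{{_ : NonZero p}} → r < p → (r + q * p) / p ≡ q
[r+q*p]/p≡q {r} {q} {p} r<p = begin
  (r + q * p) / p    ≡⟨ +-distrib-/-∣ʳ r (divides-refl q) ⟩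
  r / p + q * p / p  ≡⟨ cong₂ _+_ (m<n⇒m/n≡0 r<p) (m*n/n≡m q p) ⟩
  q                  ∎
  where open ≡-Reasoning

quotient-unique : ∀ {r r′ q q′ p} .{{_ : NonZero p}} →
  r < p → r′ < p → r + q * p ≡ r′ + q′ * p → q ≡ q′
quotient-unique r<p r′<p e = trans (sym ([r+q*p]/p≡q r<p)) (trans (/-congˡ e) ([r+q*p]/p≡q r′<p))

norm-suc : (P : ParikhVec (suc σ)) → norm P ≡ P zero + norm (P ∘ suc)
norm-suc P = cong (λ xs → P zero + sum xs) (trans (map-tabulate suc P) (sym (map-tabulate id (P ∘ suc))))

norm-zero : norm {σ} (λ _ → 0) ≡ 0
norm-zero {zero}  = refl
norm-zero {suc σ} = trans (norm-suc {σ} (λ _ → 0)) (norm-zero {σ})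

norm-+ : (P Q : ParikhVec σ) → norm (λ a → P a + Q a) ≡ norm P + norm Q
norm-+ {zero}  P Q = refl
norm-+ {suc σ} P Q = begin
  norm (λ a → P a + Q a)
    ≡⟨ norm-suc (λ a → P a + Q a) ⟩
  P zero + Q zero + norm (λ a → P (suc a) + Q (suc a))
    ≡⟨ cong (P zero + Q zero +_) (norm-+ (P ∘ suc) (Q ∘ suc)) ⟩
  P zero + Q zero + (norm (P ∘ suc) + norm (Q ∘ suc))
    ≡⟨ +-interchange (P zero) (Q zero) _ _ ⟩
  P zero + norm (P ∘ suc) + (Q zero + norm (Q ∘ suc))
    ≡⟨ sym (cong₂ _+_ (norm-suc P) (norm-suc Q)) ⟩
  norm P + norm Q
    ∎
  where open ≡-Reasoning

norm-mono : (P Q : ParikhVec σ) → (∀ a → P a ≤ Q a) → norm P ≤ norm Q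
norm-mono {zero}  P Q _   = z≤n
norm-mono {suc σ} P Q P≤Q rewrite norm-suc P | norm-suc Q =
  +-mono-≤ (P≤Q zero) (norm-mono (P ∘ suc) (Q ∘ suc) (P≤Q ∘ suc))

norm-cong : (P Q : ParikhVec σ) → P ≈ₚ Q → norm P ≡ norm Q
norm-cong P Q P≈Q =
  ≤-antisym (norm-mono P Q (≤-reflexive ∘ P≈Q)) (norm-mono Q P (≤-reflexive ∘ sym ∘ P≈Q))

norm-squeeze : (P Q : ParikhVec σ) → (∀ a → P a ≤ Q a) → norm P ≡ norm Q → P ≈ₚ Q
norm-squeeze {suc σ} P Q P≤Q e = componentwise
  where
  split : P zero + norm (P ∘ suc) ≡ Q zero + norm (Q ∘ suc)
  split = trans (sym (norm-suc P)) (trans e (norm-suc Q))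
  first : P zero ≡ Q zero
  first = +-squeezeˡ (P≤Q zero) (norm-mono (P ∘ suc) (Q ∘ suc) (P≤Q ∘ suc)) split
  componentwise : P ≈ₚ Q
  componentwise zero    = first
  componentwise (suc a) = norm-squeeze (P ∘ suc) (Q ∘ suc) (P≤Q ∘ suc)
    (+-cancelˡ-≡ (P zero) _ _ (trans split (cong (_+ _) (sym first)))) a

count-++ : (a : Fin σ) (xs ys : Word σ) → count a (xs ++ ys) ≡ count a xs + count a ys
count-++ a []       ys = refl
count-++ a (x ∷ xs) ys with x ≟ a
... | yes _ = cong suc (count-++ a xs ys)
... | no  _ = count-++ a xs ys

count-suc : (a x : Fin σ) → count (suc a) (suc x ∷ []) ≡ count a (x ∷ [])
count-suc a x with x ≟ a
... | yes _ = refl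
... | no  _ = refl

norm-letter : (x : Fin σ) → norm (parikh (x ∷ [])) ≡ 1
norm-letter {suc σ} zero    = trans (norm-suc {σ} (parikh (zero ∷ []))) (cong suc (norm-zero {σ}))
norm-letter {suc σ} (suc x) = begin
  norm (parikh (suc x ∷ []))               ≡⟨ norm-suc {σ} (parikh (suc x ∷ [])) ⟩
  norm (λ a → count (suc a) (suc x ∷ []))  ≡⟨ norm-cong _ _ (λ a → count-suc a x) ⟩
  norm (parikh (x ∷ []))                   ≡⟨ norm-letter x ⟩
  1                                        ∎
  where open ≡-Reasoning

length≡norm : (u : Word σ) → length u ≡ norm (parikh u)
length≡norm {σ} []  = sym (norm-zero {σ})
length≡norm (x ∷ u) = sym (begin
  norm (parikh (x ∷ u))                      ≡⟨ norm-cong _ _ (λ a → count-++ a (x ∷ []) u) ⟩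
  norm (λ a → count a (x ∷ []) + count a u)  ≡⟨ norm-+ (parikh (x ∷ [])) (parikh u) ⟩
  norm (parikh (x ∷ [])) + norm (parikh u)   ≡⟨ cong₂ _+_ (norm-letter x) (sym (length≡norm u)) ⟩
  suc (length u)                             ∎)
  where open ≡-Reasoning

parikh≈⇒length≡ : (u v : Word σ) → parikh u ≈ₚ parikh v → length u ≡ length v
parikh≈⇒length≡ u v u≈v = trans (length≡norm u) (trans (norm-cong _ _ u≈v) (sym (length≡norm v)))

parikh⊂⇒length< : (u v : Word σ) → parikh u ⊂ parikh v → length u < length v
parikh⊂⇒length< u v (_ , norm<) = subst₂ _<_ (sym (length≡norm u)) (sym (length≡norm v)) norm<

parikh-squeeze : (u v : Word σ) → (∀ a → count a u ≤ count a v) → length u ≡ length v → parikh u ≈ₚ parikh v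
parikh-squeeze u v u≤v |u|≡|v| =
  norm-squeeze (parikh u) (parikh v) u≤v (trans (sym (length≡norm u)) (trans |u|≡|v| (length≡norm v)))

select-positive : (a : Fin σ) (w : Word σ) (m : ℕ) {j : ℕ} → select a w (suc m) ≡ just j → 0 < j
select-positive a (x ∷ w) m sel with x ≟ a
... | yes _ with select a w m | sel
...   | just _ | refl = s≤s z≤n
select-positive a (x ∷ w) m sel | no _ with select a w (suc m) | sel
...   | just _ | refl = s≤s z≤n

select⇒count : (a : Fin σ) (w : Word σ) (m n : ℕ) →
  (∃ λ j → select a w m ≡ just j × j ≤ n) → m ≤ count a (take n w)
select⇒count a w       zero    n       _ = z≤n
select⇒count a (x ∷ w) (suc m) zero    (j , sel , j≤0) =
  contradiction j≤0 (<⇒≱ (select-positive a (x ∷ w) m sel))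
select⇒count a (x ∷ w) (suc m) (suc n) (j , sel , j≤n) with x ≟ a
... | yes _ with select a w m in e | sel | j≤n
...   | just j′ | refl | s≤s j′≤n = s≤s (select⇒count a w m n (j′ , e , j′≤n))
select⇒count a (x ∷ w) (suc m) (suc n) (j , sel , j≤n) | no _ with select a w (suc m) in e | sel | j≤n
...   | just j′ | refl | s≤s j′≤n = select⇒count a w (suc m) n (j′ , e , j′≤n)

bounded-hit-shift : {s : Maybe ℕ} {n : ℕ} →
  (∃ λ j → s ≡ just j × j ≤ n) → ∃ λ j → Maybe.map suc s ≡ just j × j ≤ suc n
bounded-hit-shift (j , s≡j , j≤n) = suc j , cong (Maybe.map suc) s≡j , s≤s j≤n

count⇒select : (a : Fin σ) (w : Word σ) (m n : ℕ) →
  m ≤ count a (take n w) → ∃ λ j → select a w m ≡ just j × j ≤ n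
count⇒select a w       zero    n       _ = 0 , refl , z≤n
count⇒select a []      (suc m) zero    ()
count⇒select a []      (suc m) (suc n) ()
count⇒select a (x ∷ w) (suc m) zero    ()
count⇒select a (x ∷ w) (suc m) (suc n) m<count with x ≟ a
... | yes _ = bounded-hit-shift (count⇒select a w m n (s≤s⁻¹ m<count))
... | no  _ = bounded-hit-shift (count⇒select a w (suc m) n m<count)

module _ {A : Set} where

  take-length-++ : (xs ys : List A) → take (length xs) (xs ++ ys) ≡ xs
  take-length-++ []       ys = refl
  take-length-++ (x ∷ xs) ys = cong (x ∷_) (take-length-++ xs ys)

  drop-length-++ : (xs ys : List A) → drop (length xs) (xs ++ ys) ≡ ys
  drop-length-++ []       ys = refl
  drop-length-++ (x ∷ xs) ys = drop-length-++ xs ys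

  take-+ : (m n : ℕ) (xs : List A) → take (m + n) xs ≡ take m xs ++ take n (drop m xs)
  take-+ zero    n xs       = refl
  take-+ (suc m) n []       = sym (take-[] n)
  take-+ (suc m) n (x ∷ xs) = cong (x ∷_) (take-+ m n xs)

  length-take-≤ : (n : ℕ) (xs : List A) → n ≤ length xs → length (take n xs) ≡ n
  length-take-≤ n xs n≤|xs| = trans (length-take n xs) (m≤n⇒m⊓n≡m n≤|xs|)

  Additive : (List A → ℕ) → Set
  Additive f = ∀ xs ys → f (xs ++ ys) ≡ f xs + f ys

  additive-[] : (f : List A → ℕ) → Additive f → f [] ≡ 0
  additive-[] f additive =
    +-cancelˡ-≡ (f []) _ _ (trans (sym (additive [] [])) (sym (+-identityʳ (f []))))

  additive-concat : (f : List A → ℕ) → Additive f → {n : ℕ} (vs : List (List A)) →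
    All (λ v → f v ≡ n) vs → f (concat vs) ≡ length vs * n
  additive-concat f additive []       []             = additive-[] f additive
  additive-concat f additive (v ∷ vs) (fv≡n ∷ rest) =
    trans (additive v (concat vs)) (cong₂ _+_ fv≡n (additive-concat f additive vs rest))

  additive-spine : (f : List A → ℕ) → Additive f → (u₀ u₁ uk : List A) (rest : List (List A)) →
    All (λ v → f v ≡ f u₁) rest →
    f (u₀ ++ (u₁ ++ (concat rest ++ uk))) ≡ f u₀ + suc (length rest) * f u₁ + f uk
  additive-spine f additive u₀ u₁ uk rest uniform = begin
    f (u₀ ++ (u₁ ++ (concat rest ++ uk)))
      ≡⟨ additive u₀ _ ⟩
    f u₀ + f (u₁ ++ (concat rest ++ uk))
      ≡⟨ cong (f u₀ +_) (additive u₁ _) ⟩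
    f u₀ + (f u₁ + f (concat rest ++ uk))
      ≡⟨ cong (λ z → f u₀ + (f u₁ + z)) (additive (concat rest) uk) ⟩
    f u₀ + (f u₁ + (f (concat rest) + f uk))
      ≡⟨ cong (λ z → f u₀ + (f u₁ + (z + f uk))) (additive-concat f additive rest uniform) ⟩
    f u₀ + (f u₁ + (length rest * f u₁ + f uk))
      ≡⟨ cong (f u₀ +_) (sym (+-assoc (f u₁) _ (f uk))) ⟩
    f u₀ + (f u₁ + length rest * f u₁ + f uk)
      ≡⟨ sym (+-assoc (f u₀) _ (f uk)) ⟩
    f u₀ + suc (length rest) * f u₁ + f uk
      ∎
    where open ≡-Reasoning

module _ {σ h p : ℕ} {u uk : Word σ} where

  head : AbelianDecomp u h p uk → Word σ
  head (u₀ , _) = u₀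

  block : AbelianDecomp u h p uk → Word σ
  block (_ , u₁ , _) = u₁

  blockCount : AbelianDecomp u h p uk → ℕ
  blockCount (_ , _ , rest , _) = suc (length rest)

  decomp-count : (d : AbelianDecomp u h p uk) (a : Fin σ) →
    count a u ≡ count a (head d) + blockCount d * count a (block d) + count a uk
  decomp-count (u₀ , u₁ , rest , refl , _ , _ , uniform , _) a =
    additive-spine (count a) (count-++ a) u₀ u₁ uk rest (All.map (λ v≈u₁ → v≈u₁ a) uniform)

  decomp-length : (d : AbelianDecomp u h p uk) → length u ≡ h + blockCount d * p + length uk
  decomp-length (u₀ , u₁ , rest , refl , refl , refl , uniform , _) =
    additive-spine length (λ xs _ → length-++ xs) u₀ u₁ uk rest
      (All.map (λ {v} → parikh≈⇒length≡ v u₁) uniform)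

  decomp-block-length : (d : AbelianDecomp u h p uk) → length (block d) ≡ p
  decomp-block-length (_ , _ , _ , _ , _ , |u₁|≡p , _) = |u₁|≡p

  decomp-head< : AbelianDecomp u h p uk → h < p
  decomp-head< (u₀ , u₁ , _ , _ , refl , refl , _ , u₀⊂u₁ , _) = parikh⊂⇒length< u₀ u₁ u₀⊂u₁

  decomp-tail< : AbelianDecomp u h p uk → length uk < p
  decomp-tail< (_ , u₁ , _ , _ , _ , refl , _ , _ , uk⊂u₁) = parikh⊂⇒length< uk u₁ uk⊂u₁

  decomp-front : ∀ {v w : Word σ} (d : AbelianDecomp u h p uk) → u ++ v ≡ w →
    take h w ≡ head d × take p (drop h w) ≡ block d
  decomp-front {v} (u₀ , u₁ , rest , refl , refl , refl , _) refl
    rewrite ++-assoc u₀ (u₁ ++ (concat rest ++ uk)) v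
          | drop-length-++ u₀ ((u₁ ++ (concat rest ++ uk)) ++ v)
          | ++-assoc u₁ (concat rest ++ uk) v
    = take-length-++ u₀ _ , take-length-++ u₁ _

decomp-quotient : ∀ {σ h p} .{{_ : NonZero p}} {u : Word σ} (d : AbelianDecomp u h p []) →
  length u / p ≡ blockCount d
decomp-quotient d =
  trans (/-congˡ (trans (decomp-length d) (+-identityʳ _))) ([r+q*p]/p≡q (decomp-head< d))

decomp-extend : ∀ {σ h p} {u : Word σ} (d : AbelianDecomp u h p []) (b : Word σ) →
  parikh b ≈ₚ parikh (block d) → AbelianDecomp (u ++ b) h p []
decomp-extend (u₀ , u₁ , rest , refl , |u₀| , |u₁| , uniform , u₀⊂u₁ , []⊂u₁) b b≈u₁ =
  u₀ , u₁ , rest ∷ʳ b , spine , |u₀| , |u₁| , ∷ʳ⁺ uniform b≈u₁ , u₀⊂u₁ , []⊂u₁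
  where
  open ≡-Reasoning
  spine : (u₀ ++ (u₁ ++ (concat rest ++ []))) ++ b ≡ u₀ ++ (u₁ ++ (concat (rest ∷ʳ b) ++ []))
  spine = begin
    (u₀ ++ (u₁ ++ (concat rest ++ []))) ++ b
      ≡⟨ ++-assoc u₀ _ b ⟩
    u₀ ++ ((u₁ ++ (concat rest ++ [])) ++ b)
      ≡⟨ cong (u₀ ++_) (++-assoc u₁ _ b) ⟩
    u₀ ++ (u₁ ++ ((concat rest ++ []) ++ b))
      ≡⟨ cong (λ z → u₀ ++ (u₁ ++ (z ++ b))) (++-identityʳ (concat rest)) ⟩
    u₀ ++ (u₁ ++ (concat rest ++ b))
      ≡⟨ cong (λ z → u₀ ++ (u₁ ++ (concat rest ++ z))) (sym (++-identityʳ b)) ⟩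
    u₀ ++ (u₁ ++ (concat rest ++ concat (b ∷ [])))
      ≡⟨ cong (λ z → u₀ ++ (u₁ ++ z)) (concat-++ rest (b ∷ [])) ⟩
    u₀ ++ (u₁ ++ concat (rest ∷ʳ b))
      ≡⟨ cong (λ z → u₀ ++ (u₁ ++ z)) (sym (++-identityʳ _)) ⟩
    u₀ ++ (u₁ ++ (concat (rest ∷ʳ b) ++ []))
      ∎

period-extension⇔ : ∀ {σ h p} .{{_ : NonZero p}} {u b : Word σ} (d : AbelianDecomp u h p []) →
  length b ≡ p →
  AbelianPeriod (u ++ b) h p ⇔
  (∀ a → count a (head d) + suc (blockCount d) * count a (block d) ≤ count a (u ++ b))
period-extension⇔ {σ} {h} {p} {u} {b} d |b|≡p = mk⇔ period⇒enough enough⇒period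
  where
  open ≡-Reasoning
  B : ℕ
  B = blockCount d

  period⇒enough : AbelianPeriod (u ++ b) h p →
    ∀ a → count a (head d) + suc B * count a (block d) ≤ count a (u ++ b)
  period⇒enough (uk , d′) a =
    ≤-trans (≤-reflexive same-start) (≤-trans (m≤m+n _ _) (≤-reflexive (sym (decomp-count d′ a))))
    where
    front : take h (u ++ b) ≡ head d × take p (drop h (u ++ b)) ≡ block d
    front = decomp-front d refl
    front′ : take h (u ++ b) ≡ head d′ × take p (drop h (u ++ b)) ≡ block d′
    front′ = decomp-front d′ (++-identityʳ (u ++ b))
    lengths : h + (0 + suc B * p) ≡ h + (length uk + blockCount d′ * p)
    lengths = begin
      h + (0 + suc B * p)                  ≡⟨ cong (h +_) (+-comm p (B * p)) ⟩
      h + (B * p + p)                      ≡⟨ sym (+-assoc h (B * p) p) ⟩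
      h + B * p + p                        ≡⟨ cong₂ _+_ (sym (trans (decomp-length d) (+-identityʳ _)))
                                                        (sym |b|≡p) ⟩
      length u + length b                  ≡⟨ sym (length-++ u) ⟩
      length (u ++ b)                      ≡⟨ decomp-length d′ ⟩
      h + blockCount d′ * p + length uk    ≡⟨ +-assoc h _ (length uk) ⟩
      h + (blockCount d′ * p + length uk)  ≡⟨ cong (h +_) (+-comm _ (length uk)) ⟩
      h + (length uk + blockCount d′ * p)  ∎
    one-more-block : suc B ≡ blockCount d′
    one-more-block = quotient-unique (>-nonZero⁻¹ p) (decomp-tail< d′) (+-cancelˡ-≡ h _ _ lengths)
    same-start : count a (head d) + suc B * count a (block d)
               ≡ count a (head d′) + blockCount d′ * count a (block d′)
    same-start = cong₂ (λ x y → count a x + y)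
      (trans (sym (proj₁ front)) (proj₁ front′))
      (cong₂ _*_ one-more-block (cong (count a) (trans (sym (proj₂ front)) (proj₂ front′))))

  enough⇒period : (∀ a → count a (head d) + suc B * count a (block d) ≤ count a (u ++ b)) →
    AbelianPeriod (u ++ b) h p
  enough⇒period enough =
    [] , decomp-extend d b (λ a → sym (parikh-squeeze (block d) b block≤b |block|≡|b| a))
    where
    |block|≡|b| : length (block d) ≡ length b
    |block|≡|b| = trans (decomp-block-length d) (sym |b|≡p)
    block≤b : ∀ a → count a (block d) ≤ count a b
    block≤b a = +-cancelˡ-≤ (c₀ + B * c₁) c₁ (count a b) (subst₂ _≤_ shuffle counts (enough a))
      where
      c₀ c₁ : ℕ
      c₀ = count a (head d)
      c₁ = count a (block d)
      shuffle : c₀ + suc B * c₁ ≡ c₀ + B * c₁ + c₁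
      shuffle = trans (cong (c₀ +_) (+-comm c₁ (B * c₁))) (sym (+-assoc c₀ _ c₁))
      counts : count a (u ++ b) ≡ c₀ + B * c₁ + count a b
      counts = trans (count-++ a u b) (cong (_+ count a b) (trans (decomp-count d a) (+-identityʳ _)))

lemma2 : ∀ {σ : ℕ} (w : Word σ) (h p k i : ℕ) .{{_ : NonZero p}}
    → i ≡ h + k * p
    → 0 < k
    → p ≤ length w ∸ i
    → AbelianPeriodEmptyTail (take i w) h p
    → (AbelianPeriod (take (i + p) w) h p
       ⇔ (∀ (a : Fin σ) → ∃ λ j →
            (select a w (parikhFactor w 1 h a + (1 + i / p) * parikhFactor w (h + 1) p a) ≡ just j)
            × j ≤ i + p))
lemma2 {σ} w h p _ i _ _ p≤|w|∸i d = mk⇔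
  (λ period a → count⇒select a w _ (i + p)
     (subst₂ _≤_ (sym (rank a)) (cong (count a) (sym prefix-split))
       (Equivalence.to extension (subst (λ x → AbelianPeriod x h p) prefix-split period) a)))
  (λ hits → subst (λ x → AbelianPeriod x h p) (sym prefix-split)
     (Equivalence.from extension (λ a →
       subst₂ _≤_ (rank a) (cong (count a) prefix-split) (select⇒count a w _ (i + p) (hits a)))))
  where
  b : Word σ
  b = take p (drop i w)

  prefix-split : take (i + p) w ≡ take i w ++ b
  prefix-split = take-+ i p w

  extension : AbelianPeriod (take i w ++ b) h p ⇔
    (∀ a → count a (head d) + suc (blockCount d) * count a (block d) ≤ count a (take i w ++ b))
  extension = period-extension⇔ d (length-take-≤ p (drop i w) (subst (p ≤_) (sym (length-drop i w)) p≤|w|∸i))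

  -- p > 0 forces i < |w|, so the prefix of length i is complete.
  |take-i-w|≡i : length (take i w) ≡ i
  |take-i-w|≡i = length-take-≤ i w (<⇒≤ (m∸n≢0⇒n<m λ |w|∸i≡0 →
    ≢-nonZero⁻¹ p (n≤0⇒n≡0 (subst (p ≤_) |w|∸i≡0 p≤|w|∸i))))

  front : take h w ≡ head d × take p (drop h w) ≡ block d
  front = decomp-front d (take++drop≡id i w)

  rank : ∀ a → parikhFactor w 1 h a + (1 + i / p) * parikhFactor w (h + 1) p a
             ≡ count a (head d) + suc (blockCount d) * count a (block d)
  rank a = cong₂ (λ x y → count a x + y) (proj₁ front)
    (cong₂ _*_ (cong suc (trans (/-congˡ (sym |take-i-w|≡i)) (decomp-quotient d)))
      (cong (count a) (trans (cong (λ s → take p (drop s w)) (m+n∸n≡m h 1)) (proj₂ front))))
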